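{- Let $i\ge 7$. The string $F_{i-3}\,F_{i-6}\,F_{i-5}$ and its prefix of length $f_{i-2}-1$ each occur exactly once in $F_i$.
   Context: Fibonacci words: $F_1=\texttt{b}$, $F_2=\texttt{a}$, $F_k=F_{k-1}F_{k-2}$ for $k\ge 3$; $f_k=|F_k|$. -}

module Defs where

open import Data.Nat using (ℕ; zero; suc; _+_; _≤_)
open import Data.List using (List; []; _∷_; _++_; length; take; drop)
open import Data.Product using (Σ; _×_)
open import Relation.Binary.PropositionalEquality using (_≡_)

data Letter : Set where
  a b : Letter

Word : Set
Word = List Letter

-- Fibonacci words, 1-indexed: F 1 = b, F 2 = a, F (k) = F (k-1) F (k-2) for k ≥ 3.
-- F 0 is an unused junk value (the empty word).
F : ℕ → Word
F zero = []
F (suc zero) = b ∷ []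
F (suc (suc zero)) = a ∷ []
F (suc (suc (suc k))) = F (suc (suc k)) ++ F (suc k)

f : ℕ → ℕ
f k = length (F k)

OccursAt : Word → Word → ℕ → Set
OccursAt u w p = (p + length u ≤ length w) × (take (length u) (drop p w) ≡ u)

OccursExactlyOnce : Word → Word → Set
OccursExactlyOnce u w = Σ ℕ (λ p → OccursAt u w p × (∀ q → OccursAt u w q → q ≡ p))

-- The Fibonacci morphism φ (a ↦ ab, b ↦ a) maps F k to F (k + 1), hence maps
-- W = F (i-3) F (i-6) F (i-5) to the corresponding word for i + 1.  Write W = P c with
-- c a letter, so P is the prefix of length f (i-2) - 1.  Then P evolves as P ↦ (φ P) a
-- if c = a, and P ↦ φ P if c = b, in which case P ends in a.  An occurrence of the new
-- P in φ w begins with a, hence at a cut between φ-blocks, and desubstitutes to an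
-- occurrence of the old P in w; so uniqueness of P propagates from i = 7, where it is
-- checked by hand.  Finally W occurs at f (i-3) because F i = F (i-3) W F (i-2), and
-- every occurrence of W is one of P.
module Submission where

open import Defs
open import Data.Nat using (ℕ; zero; suc; _+_; _∸_; _≤_; s≤s)
open import Data.Nat.Properties using (m≤n⇒∃[o]m+o≡n; +-cancelˡ-≤; m+n≤o⇒n≤o; 1+n≰n; m+n∸n≡m)
open import Data.List using ([]; _∷_; _++_; _∷ʳ_; [_]; take; drop; length)
open import Data.List.Properties
  using (++-assoc; ++-identityʳ; length-++; length-++-comm; length-++-≤ˡ; ∷-injectiveʳ; take++drop≡id)
open import Data.Product using (_×_; _,_; ∃-syntax)
open import Function using (_∘_)
open import Relation.Nullary using (contradiction)
open import Relation.Binary.PropositionalEquality using (_≡_; refl; sym; trans; cong; cong₂; subst; subst₂; module ≡-Reasoning)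
open ≡-Reasoning

φ : Word → Word
φ [] = []
φ (a ∷ w) = a ∷ b ∷ φ w
φ (b ∷ w) = a ∷ φ w

φ-++ : ∀ u v → φ (u ++ v) ≡ φ u ++ φ v
φ-++ [] v = refl
φ-++ (a ∷ u) v = cong (λ t → a ∷ b ∷ t) (φ-++ u v)
φ-++ (b ∷ u) v = cong (a ∷_) (φ-++ u v)

φ-++³ : ∀ u v w → φ (u ++ v ++ w) ≡ φ u ++ φ v ++ φ w
φ-++³ u v w = trans (φ-++ u (v ++ w)) (cong (φ u ++_) (φ-++ v w))

φ-F : ∀ n → φ (F (suc n)) ≡ F (suc (suc n))
φ-F zero = refl
φ-F (suc zero) = refl
φ-F (suc (suc n)) = trans (φ-++ (F (suc (suc n))) (F (suc n))) (cong₂ _++_ (φ-F (suc n)) (φ-F n))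

φ-injective : ∀ u v → φ u ≡ φ v → u ≡ v
φ-injective [] [] _ = refl
φ-injective (a ∷ u) (a ∷ v) e = cong (a ∷_) (φ-injective u v (∷-injectiveʳ (∷-injectiveʳ e)))
φ-injective (b ∷ u) (b ∷ v) e = cong (b ∷_) (φ-injective u v (∷-injectiveʳ e))
φ-injective [] (a ∷ v) ()
φ-injective [] (b ∷ v) ()
φ-injective (a ∷ u) [] ()
φ-injective (b ∷ u) [] ()
φ-injective (a ∷ u) (b ∷ []) ()
φ-injective (a ∷ u) (b ∷ a ∷ v) ()
φ-injective (a ∷ u) (b ∷ b ∷ v) ()
φ-injective (b ∷ []) (a ∷ v) ()
φ-injective (b ∷ a ∷ u) (a ∷ v) ()
φ-injective (b ∷ b ∷ u) (a ∷ v) ()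

-- The suffixes of φ w that begin at a cut between two blocks: every block φ c starts with a.
data BlockStart : Word → Set where
  at-end : BlockStart []
  at-a : ∀ z → BlockStart (a ∷ z)

φ-blockStart : ∀ w → BlockStart (φ w)
φ-blockStart [] = at-end
φ-blockStart (a ∷ w) = at-a _
φ-blockStart (b ∷ w) = at-a _

φ-after-b : ∀ w x y → φ w ≡ x ++ b ∷ y → BlockStart y
φ-after-b (a ∷ w) (a ∷ []) y e = subst BlockStart (∷-injectiveʳ (∷-injectiveʳ e)) (φ-blockStart w)
φ-after-b (a ∷ w) (a ∷ b ∷ x) y e = φ-after-b w x y (∷-injectiveʳ (∷-injectiveʳ e))
φ-after-b (b ∷ w) (a ∷ x) y e = φ-after-b w x y (∷-injectiveʳ e)
φ-after-b [] [] y ()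
φ-after-b [] (_ ∷ x) y ()
φ-after-b (a ∷ w) [] y ()
φ-after-b (a ∷ w) (a ∷ a ∷ x) y ()
φ-after-b (a ∷ w) (b ∷ x) y ()
φ-after-b (b ∷ w) [] y ()
φ-after-b (b ∷ w) (b ∷ x) y ()

φ-split : ∀ w x z → φ w ≡ x ++ z → BlockStart z →
          ∃[ w₁ ] ∃[ w₂ ] w ≡ w₁ ++ w₂ × φ w₁ ≡ x × φ w₂ ≡ z
φ-split w [] z e _ = [] , w , refl , refl , e
φ-split (a ∷ w) (a ∷ []) _ refl ()
φ-split (a ∷ w) (a ∷ b ∷ x) z e s
  with w₁ , w₂ , refl , refl , φw₂≡z ← φ-split w x z (∷-injectiveʳ (∷-injectiveʳ e)) s
  = a ∷ w₁ , w₂ , refl , refl , φw₂≡z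
φ-split (b ∷ w) (a ∷ x) z e s
  with w₁ , w₂ , refl , refl , φw₂≡z ← φ-split w x z (∷-injectiveʳ e) s
  = b ∷ w₁ , w₂ , refl , refl , φw₂≡z
φ-split [] (_ ∷ x) z () _
φ-split (a ∷ w) (a ∷ a ∷ x) z () _
φ-split (a ∷ w) (b ∷ x) z () _
φ-split (b ∷ w) (b ∷ x) z () _

φ-desubstitute : ∀ w u z → φ w ≡ φ u ++ z → BlockStart z → ∃[ v ] w ≡ u ++ v
φ-desubstitute w u z e s with w₁ , w₂ , refl , φw₁≡φu , _ ← φ-split w (φ u) z e s
  = w₂ , cong (_++ w₂) (φ-injective w₁ u φw₁≡φu)

Desubstitutes : Word → Word → Set
Desubstitutes u′ u = ∀ w y → φ w ≡ u′ ++ y → ∃[ v ] w ≡ u ++ v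

φ-∷ʳa-desubstitutes : ∀ u → Desubstitutes (φ u ∷ʳ a) u
φ-∷ʳa-desubstitutes u w y e = φ-desubstitute w u (a ∷ y) (trans e (++-assoc (φ u) [ a ] y)) (at-a y)

φ-of-∷ʳa-desubstitutes : ∀ u → Desubstitutes (φ (u ∷ʳ a)) (u ∷ʳ a)
φ-of-∷ʳa-desubstitutes u w y e = φ-desubstitute w (u ∷ʳ a) y e (φ-after-b w (φ u ∷ʳ a) y ends-ab)
  where
    ends-ab : φ w ≡ (φ u ∷ʳ a) ++ b ∷ y
    ends-ab = begin
      φ w                          ≡⟨ e ⟩
      φ (u ∷ʳ a) ++ y              ≡⟨ cong (_++ y) (φ-++ u [ a ]) ⟩
      (φ u ++ a ∷ b ∷ []) ++ y     ≡⟨ ++-assoc (φ u) (a ∷ b ∷ []) y ⟩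
      φ u ++ a ∷ b ∷ y             ≡⟨ ++-assoc (φ u) [ a ] (b ∷ y) ⟨
      (φ u ∷ʳ a) ++ b ∷ y          ∎

OccursOnlyAt : Word → Word → ℕ → Set
OccursOnlyAt u w p = ∀ q → OccursAt u w q → q ≡ p

take-length-++ : ∀ (u v : Word) → take (length u) (u ++ v) ≡ u
take-length-++ [] v = refl
take-length-++ (c ∷ u) v = cong (c ∷_) (take-length-++ u v)

occursAt-++ : ∀ x u y → OccursAt u (x ++ u ++ y) (length x)
occursAt-++ [] u y = length-++-≤ˡ u , take-length-++ u y
occursAt-++ (c ∷ x) u y with fits , matches ← occursAt-++ x u y = s≤s fits , matches

occursAt⇒split : ∀ {u} w p → OccursAt u w p → ∃[ x ] ∃[ y ] w ≡ x ++ u ++ y × length x ≡ p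
occursAt⇒split {u} w zero (_ , matches) =
  [] , drop (length u) w , trans (sym (take++drop≡id (length u) w)) (cong (_++ drop (length u) w) matches) , refl
occursAt⇒split (c ∷ w) (suc p) (s≤s fits , matches)
  with x , y , refl , refl ← occursAt⇒split w p (fits , matches)
  = c ∷ x , y , refl , refl

occursAt-prefix : ∀ {u v w q} → OccursAt (u ++ v) w q → OccursAt u w q
occursAt-prefix {u} {v} {w} {q} occ with x , y , refl , refl ← occursAt⇒split w q occ =
  subst (λ t → OccursAt u t (length x)) (cong (x ++_) (sym (++-assoc u v y))) (occursAt-++ x u (v ++ y))

occursOnlyAt-φ : ∀ {u u′ w p} → ∃[ z ] u′ ≡ a ∷ z → Desubstitutes u′ u →
                 OccursOnlyAt u w p → OccursOnlyAt u′ (φ w) (length (φ (take p w)))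
occursOnlyAt-φ {u} {w = w} {p} (z , refl) desub only q occ
  with x , y , φw≡ , refl ← occursAt⇒split (φ w) q occ
  with w₁ , w₂ , refl , refl , φw₂≡ ← φ-split w x _ φw≡ (at-a _)
  with v , refl ← desub w₂ y φw₂≡
  = cong (length ∘ φ) (sym take-p≡w₁)
  where
    |w₁|≡p : length w₁ ≡ p
    |w₁|≡p = only (length w₁) (occursAt-++ w₁ u v)
    take-p≡w₁ : take p (w₁ ++ u ++ v) ≡ w₁
    take-p≡w₁ = trans (cong (λ n → take n (w₁ ++ u ++ v)) (sym |w₁|≡p)) (take-length-++ w₁ (u ++ v))

-- The word F (i-3) F (i-6) F (i-5) for i = 7 + j.
W : ℕ → Word
W j = F (4 + j) ++ F (1 + j) ++ F (2 + j)

φ-W : ∀ j → φ (W j) ≡ W (suc j)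
φ-W j = trans (φ-++³ (F (4 + j)) (F (1 + j)) (F (2 + j)))
              (cong₂ _++_ (φ-F (3 + j)) (cong₂ _++_ (φ-F j) (φ-F (1 + j))))

F-split : ∀ j → F (7 + j) ≡ F (4 + j) ++ W j ++ F (5 + j)
F-split zero = refl
F-split (suc j) = begin
  F (8 + j)                                   ≡⟨ φ-F (6 + j) ⟨
  φ (F (7 + j))                               ≡⟨ cong φ (F-split j) ⟩
  φ (F (4 + j) ++ W j ++ F (5 + j))           ≡⟨ φ-++³ (F (4 + j)) (W j) (F (5 + j)) ⟩
  φ (F (4 + j)) ++ φ (W j) ++ φ (F (5 + j))   ≡⟨ cong₂ _++_ (φ-F (3 + j)) (cong₂ _++_ (φ-W j) (φ-F (4 + j))) ⟩
  F (5 + j) ++ W (suc j) ++ F (6 + j)         ∎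

length-W : ∀ j → length (W j) ≡ f (5 + j)
length-W j = begin
  length (F (4 + j) ++ F (1 + j) ++ F (2 + j))  ≡⟨ length-++ (F (4 + j)) ⟩
  f (4 + j) + length (F (1 + j) ++ F (2 + j))   ≡⟨ cong (f (4 + j) +_) (length-++-comm (F (1 + j)) (F (2 + j))) ⟩
  f (4 + j) + f (3 + j)                         ≡⟨ length-++ (F (4 + j)) ⟨
  f (5 + j)                                     ∎

flip : Letter → Letter
flip a = b
flip b = a

ι : Letter → Word
ι a = [ a ]
ι b = []

φ-∷ʳ : ∀ u c → φ (u ∷ʳ c) ≡ (φ u ++ ι c) ∷ʳ flip c
φ-∷ʳ u c = begin
  φ (u ∷ʳ c)                 ≡⟨ φ-++ u [ c ] ⟩
  φ u ++ φ [ c ]             ≡⟨ cong (φ u ++_) (φ-letter c) ⟩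
  φ u ++ ι c ++ [ flip c ]   ≡⟨ ++-assoc (φ u) (ι c) [ flip c ] ⟨
  (φ u ++ ι c) ∷ʳ flip c     ∎
  where
    φ-letter : ∀ c → φ [ c ] ≡ ι c ∷ʳ flip c
    φ-letter a = refl
    φ-letter b = refl

W-last : ℕ → Letter
W-last zero = a
W-last (suc j) = flip (W-last j)

W-init : ℕ → Word
W-init zero = a ∷ b ∷ a ∷ b ∷ []
W-init (suc j) = φ (W-init j) ++ ι (W-last j)

W≡W-init∷ʳW-last : ∀ j → W j ≡ W-init j ∷ʳ W-last j
W≡W-init∷ʳW-last zero = refl
W≡W-init∷ʳW-last (suc j) = begin
  W (suc j)                      ≡⟨ φ-W j ⟨
  φ (W j)                        ≡⟨ cong φ (W≡W-init∷ʳW-last j) ⟩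
  φ (W-init j ∷ʳ W-last j)       ≡⟨ φ-∷ʳ (W-init j) (W-last j) ⟩
  W-init (suc j) ∷ʳ W-last (suc j) ∎

take-W : ∀ j → take (f (5 + j) ∸ 1) (W j) ≡ W-init j
take-W j = begin
  take (f (5 + j) ∸ 1) (W j)                                       ≡⟨ cong (λ n → take (n ∸ 1) (W j)) (length-W j) ⟨
  take (length (W j) ∸ 1) (W j)                                    ≡⟨ cong (λ w → take (length w ∸ 1) w) (W≡W-init∷ʳW-last j) ⟩
  take (length (W-init j ∷ʳ W-last j) ∸ 1) (W-init j ∷ʳ W-last j)  ≡⟨ cong (λ n → take n (W-init j ∷ʳ W-last j)) length-init ⟩
  take (length (W-init j)) (W-init j ∷ʳ W-last j)                  ≡⟨ take-length-++ (W-init j) [ W-last j ] ⟩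
  W-init j                                                         ∎
  where
    length-init : length (W-init j ∷ʳ W-last j) ∸ 1 ≡ length (W-init j)
    length-init = trans (cong (_∸ 1) (length-++ (W-init j))) (m+n∸n≡m (length (W-init j)) 1)

W-init-head : ∀ j → ∃[ z ] W-init j ≡ a ∷ z
W-init-head zero = _ , refl
W-init-head (suc j) with z , eq ← W-init-head j = _ , cong (λ v → φ v ++ ι (W-last j)) eq

W-init-desubstitutes : ∀ j → Desubstitutes (W-init (suc j)) (W-init j)
W-init-desubstitutes zero = φ-∷ʳa-desubstitutes (W-init zero)
W-init-desubstitutes (suc j) = step (W-last j)
  where
    step : ∀ c → Desubstitutes (φ (φ (W-init j) ++ ι c) ++ ι (flip c)) (φ (W-init j) ++ ι c)
    step a = subst (λ u′ → Desubstitutes u′ (φ (W-init j) ∷ʳ a)) (sym (++-identityʳ _))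
                   (φ-of-∷ʳa-desubstitutes (φ (W-init j)))
    step b = φ-∷ʳa-desubstitutes (φ (W-init j) ++ [])

W-init₀-occursOnlyAt : OccursOnlyAt (W-init 0) (F 7) 3
W-init₀-occursOnlyAt 0 (_ , ())
W-init₀-occursOnlyAt 1 (_ , ())
W-init₀-occursOnlyAt 2 (_ , ())
W-init₀-occursOnlyAt 3 _ = refl
W-init₀-occursOnlyAt 4 (_ , ())
W-init₀-occursOnlyAt 5 (_ , ())
W-init₀-occursOnlyAt 6 (_ , ())
W-init₀-occursOnlyAt 7 (_ , ())
W-init₀-occursOnlyAt 8 (_ , ())
W-init₀-occursOnlyAt 9 (_ , ())
W-init₀-occursOnlyAt (suc (suc (suc (suc (suc (suc (suc (suc (suc (suc q)))))))))) (fits , _) =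
  contradiction (m+n≤o⇒n≤o q (+-cancelˡ-≤ 10 (q + 4) 3 fits)) 1+n≰n

take-F : ∀ j → take (f (4 + j)) (F (7 + j)) ≡ F (4 + j)
take-F j = trans (cong (take (f (4 + j))) (F-split j)) (take-length-++ (F (4 + j)) _)

W-init-occursOnlyAt : ∀ j → OccursOnlyAt (W-init j) (F (7 + j)) (f (4 + j))
W-init-occursOnlyAt zero = W-init₀-occursOnlyAt
W-init-occursOnlyAt (suc j) =
  subst₂ (OccursOnlyAt (W-init (suc j))) (φ-F (6 + j)) (cong length (trans (cong φ (take-F j)) (φ-F (3 + j))))
    (occursOnlyAt-φ (W-init-head (suc j)) (W-init-desubstitutes j) (W-init-occursOnlyAt j))

W-occursAt : ∀ j → OccursAt (W j) (F (7 + j)) (f (4 + j))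
W-occursAt j = subst (λ w → OccursAt (W j) w (f (4 + j))) (sym (F-split j)) (occursAt-++ (F (4 + j)) (W j) (F (5 + j)))

W-occursAt⇒W-init-occursAt : ∀ j {w q} → OccursAt (W j) w q → OccursAt (W-init j) w q
W-occursAt⇒W-init-occursAt j {w} {q} = occursAt-prefix ∘ subst (λ u → OccursAt u w q) (W≡W-init∷ʳW-last j)

lemma29 : (i : ℕ) → 7 ≤ i →
    OccursExactlyOnce (F (i ∸ 3) ++ F (i ∸ 6) ++ F (i ∸ 5)) (F i)
    × OccursExactlyOnce (take (f (i ∸ 2) ∸ 1) (F (i ∸ 3) ++ F (i ∸ 6) ++ F (i ∸ 5))) (F i)
lemma29 i 7≤i with j , refl ← m≤n⇒∃[o]m+o≡n 7≤i =
    (f (4 + j) , W-occursAt j , λ q → W-init-occursOnlyAt j q ∘ W-occursAt⇒W-init-occursAt j)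
  , subst (λ u → OccursExactlyOnce u (F (7 + j))) (sym (take-W j))
      (f (4 + j) , W-occursAt⇒W-init-occursAt j (W-occursAt j) , W-init-occursOnlyAt j)
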